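{- Let $\mathcal N$ be an orchard network on $X$ with vertex set $V$, and let $\{v_1,v_2,v_3\}$ be a 3-element subset of $V-X$. If $v_i$ and $v_j$ are clones for all distinct $i,j\in\{1,2,3\}$, then $\mathcal N$ has a sink of size at least two, and at least two of the vertices in $\{v_1,v_2,v_3\}$ are in the same sink.
   Context: A phylogenetic network on a non-empty finite set $X$ is a rooted acyclic directed graph with no parallel arcs such that: (i) the unique root has in-degree $0$ and out-degree $2$; (ii) every vertex of out-degree $0$ has in-degree $1$, and the set of vertices of out-degree $0$ (the leaves) is $X$; (iii) every other vertex either has in-degree $1$ and out-degree $2$ (a tree vertex) or in-degree at least $2$ and out-degree $1$ (a reticulation). If $|X|=1$, a single vertex is also allowed. If $(u,v)$ is an arc, $u$ is a parent of $v$. A 2-element subset $\{a,b\}\subseteq X$ with parents $p_a,p_b$ is a cherry if $p_a=p_b$; it is a reticulated cherry with reticulation leaf $b$ if $p_b$ is a reticulation and $(p_a,p_b)$ is an arc. Reducing $b$ in a cherry: delete $b$ and suppress the resulting in-degree-1 out-degree-1 vertex (if the common parent is the root, delete $b$ and the root). Cutting a reticulated cherry $\{a,b\}$: delete the arc $(p_a,p_b)$ and suppress any resulting in-degree-1 out-degree-1 vertices. A phylogenetic network is orchard if some sequence of these cherry reductions transforms it into a single vertex. Two distinct non-leaf vertices $u,w$ are clones if, for every leaf $x\in X$, the number of directed paths from $u$ to $x$ equals the number of directed paths from $w$ to $x$. Sinks: on $V-X$ define $u\sim' v$ if $u,v$ are reticulations and $(u,v)$ or $(v,u)$ is an arc;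 the equivalence classes of the reflexive–transitive closure of $\sim'$ are the sinks. -}

module Defs where

open import Data.Nat using (ℕ; zero; suc; _+_; _≤_; _≟_)
open import Data.Nat.ListAction using (sum)
open import Data.Bool using (if_then_else_)
open import Data.List using (List; []; _∷_; map; filter; length)
open import Data.List.Membership.Propositional using (_∈_)
open import Data.List.Relation.Unary.Unique.Propositional using (Unique)
open import Data.Product using (_×_; _,_; proj₁; proj₂; ∃)
open import Data.Product.Properties using () renaming (≡-dec to ×-≡-dec)
open import Data.Sum using (_⊎_)
open import Relation.Nullary using (¬_; ¬?; _×-dec_; does)
open import Relation.Binary.PropositionalEquality using (_≡_; _≢_)
open import Relation.Binary.Construct.Closure.Transitive using (TransClosure)
open import Relation.Binary.Construct.Closure.ReflexiveTransitive using (Star)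

-- Finite directed graphs with vertices labelled by natural numbers.
-- V = vertex list, E = arc list (pairs (tail , head)).

record Graph : Set where
  constructor graph
  field
    V : List ℕ
    E : List (ℕ × ℕ)
open Graph public

Arc : Graph → ℕ → ℕ → Set
Arc G u w = (u , w) ∈ E G

parents : Graph → ℕ → List ℕ
parents G v = map proj₁ (filter (λ e → proj₂ e ≟ v) (E G))

children : Graph → ℕ → List ℕ
children G v = map proj₂ (filter (λ e → proj₁ e ≟ v) (E G))

indeg : Graph → ℕ → ℕ
indeg G v = length (parents G v)

outdeg : Graph → ℕ → ℕ
outdeg G v = length (children G v)

-- Phylogenetic networks (the leaf set X is the set of out-degree-0 vertices)

record IsProperNetwork (G : Graph) : Set where
  field
    uniqueV    : Unique (V G)
    uniqueE    : Unique (E G)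
    arcsInV    : ∀ {u w} → Arc G u w → u ∈ V G × w ∈ V G
    acyclic    : ∀ {u} → ¬ TransClosure (Arc G) u u
    root       : ℕ
    rootInV    : root ∈ V G
    rootIndeg  : indeg G root ≡ 0
    rootOutdeg : outdeg G root ≡ 2
    rootUnique : ∀ {v} → v ∈ V G → indeg G v ≡ 0 → v ≡ root
    leafCond   : ∀ {v} → v ∈ V G → outdeg G v ≡ 0 → indeg G v ≡ 1
    innerCond  : ∀ {v} → v ∈ V G → v ≢ root → ¬ (outdeg G v ≡ 0) →
                 (indeg G v ≡ 1 × outdeg G v ≡ 2) ⊎ (2 ≤ indeg G v × outdeg G v ≡ 1)

SingleVertex : Graph → Set
SingleVertex G = ∃ λ v → V G ≡ v ∷ [] × E G ≡ []

IsNetwork : Graph → Set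
IsNetwork G = SingleVertex G ⊎ IsProperNetwork G

Leaf : Graph → ℕ → Set
Leaf G x = x ∈ V G × outdeg G x ≡ 0

NonLeaf : Graph → ℕ → Set
NonLeaf G v = v ∈ V G × ¬ (outdeg G v ≡ 0)

Reticulation : Graph → ℕ → Set
Reticulation G v = v ∈ V G × 2 ≤ indeg G v

removeVertex : ℕ → Graph → Graph
removeVertex v G =
  graph (filter (λ x → ¬? (x ≟ v)) (V G))
        (filter (λ e → ¬? (proj₁ e ≟ v) ×-dec ¬? (proj₂ e ≟ v)) (E G))

removeArc : ℕ × ℕ → Graph → Graph
removeArc a G = graph (V G) (filter (λ e → ¬? (×-≡-dec _≟_ _≟_ e a)) (E G))

suppressWith : ℕ → Graph → List ℕ → List ℕ → Graph
suppressWith v G (u ∷ []) (w ∷ []) =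
  let G' = removeVertex v G in graph (V G') ((u , w) ∷ E G')
suppressWith v G _ _ = G

suppress : ℕ → Graph → Graph
suppress v G = suppressWith v G (parents G v) (children G v)

reduceCherry : Graph → ℕ → ℕ → Graph
reduceCherry G b p =
  let G₁ = removeVertex b G in
  if does (indeg G p ≟ 0) then removeVertex p G₁ else suppress p G₁

cutRetCherry : Graph → ℕ → ℕ → Graph
cutRetCherry G pa pb = suppress pb (suppress pa (removeArc (pa , pb) G))

IsCherry : Graph → ℕ → ℕ → ℕ → Set
IsCherry G a b p = a ≢ b × Leaf G a × Leaf G b × Arc G p a × Arc G p b

IsRetCherry : Graph → ℕ → ℕ → ℕ → ℕ → Set
IsRetCherry G a b pa pb =
  a ≢ b × Leaf G a × Leaf G b × Arc G pa a × Arc G pb b ×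
  Reticulation G pb × Arc G pa pb

data Orchard : Graph → Set where
  done    : ∀ {G} → SingleVertex G → Orchard G
  reduce  : ∀ {G} a b p → IsCherry G a b p →
            Orchard (reduceCherry G b p) → Orchard G
  cut     : ∀ {G} a b pa pb → IsRetCherry G a b pa pb →
            Orchard (cutRetCherry G pa pb) → Orchard G

OrchardNetwork : Graph → Set
OrchardNetwork G = IsNetwork G × Orchard G

-- Number of directed paths from u to x.
-- pathsUpTo f G u x counts directed paths of length ≤ f; in an acyclic
-- graph every path has length < |V|, so numPaths counts all of them.

pathsUpTo : ℕ → Graph → ℕ → ℕ → ℕ
pathsUpTo zero    G u x = if does (u ≟ x) then 1 else 0
pathsUpTo (suc f) G u x =
  (if does (u ≟ x) then 1 else 0) + sum (map (λ c → pathsUpTo f G c x) (children G u))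

numPaths : Graph → ℕ → ℕ → ℕ
numPaths G u x = pathsUpTo (length (V G)) G u x

Clones : Graph → ℕ → ℕ → Set
Clones G u w =
  u ≢ w × NonLeaf G u × NonLeaf G w ×
  (∀ x → Leaf G x → numPaths G u x ≡ numPaths G w x)

-- Sinks: classes of the reflexive–transitive closure of ∼' on V − X

RetAdj : Graph → ℕ → ℕ → Set
RetAdj G u v = Reticulation G u × Reticulation G v × (Arc G u v ⊎ Arc G v u)

SameSink : Graph → ℕ → ℕ → Set
SameSink G u v = NonLeaf G u × NonLeaf G v × Star (RetAdj G) u v

HasSinkOfSize≥2 : Graph → Set
HasSinkOfSize≥2 G = ∃ λ u → ∃ λ v → u ≢ v × SameSink G u v

-- Path counts numPaths G _ x are the unique solution of π y = [y ≡ x] + Σ_{c child of y} π c,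
-- which lets us follow them through an orchard reduction sequence. Deleting a cherry leaf or
-- suppressing a vertex leaves the counts between the remaining vertices unchanged; deleting the
-- arc (s , t) of a reticulated cherry {a , b} turns numPaths y x into π₁ y x + k · π₁ t x · π₁ y s,
-- where π₁ counts paths avoiding the arc, and the correction terms of two clones agree because
-- their path counts to the leaf a below s are their π₁-counts to s. By induction along the
-- sequence any two clones are comparable: one descends from the other (a clone of a cherry parent
-- reaches that parent through its leaf). If u reaches w with the same path counts, every vertex on
-- the path has a single child, since a second child would add paths to some leaf; so it is a
-- reticulation and the path runs inside one sink. Among three pairwise comparable clones two such
-- paths s ⇝ m ⇝ y are consecutive, and s , m share a sink.

module Submission where

open import Defs
open import Data.Nat using (ℕ; zero; suc; _+_; _*_; _≤_; _≟_; z≤n; s≤s)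
open import Data.Nat.Properties
open import Algebra.Properties.CommutativeSemigroup +-commutativeSemigroup using (interchange; x∙yz≈y∙xz)
open import Data.Nat.ListAction using (sum)
open import Data.Bool using (if_then_else_)
open import Data.List using (List; []; _∷_; map; filter; length)
open import Data.List.Properties using (map-cong-local; filter-all; filter-accept; filter-reject; length-filter)
open import Data.List.Membership.Propositional using (_∈_)
open import Data.List.Membership.DecPropositional _≟_ using (_∈?_)
open import Data.List.Membership.Propositional.Properties
  using (∈-filter⁺; ∈-filter⁻; ∈-map∘filter⁻; ∈-map∘filter⁺)
open import Data.List.Relation.Unary.Any using (here; there)
open import Data.List.Relation.Unary.Any.Properties using (¬Any[])
import Data.List.Relation.Unary.All as All
import Data.List.Relation.Unary.AllPairs as AllPairs
open AllPairs using (_∷_)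
open import Data.List.Relation.Unary.Unique.Propositional using (Unique)
open import Data.Product using (_×_; _,_; proj₁; proj₂; ∃)
open import Data.Product.Properties using () renaming (≡-dec to ×-≡-dec)
open import Data.Sum using (_⊎_; inj₁; inj₂; [_,_]′; swap)
open import Data.Empty using (⊥; ⊥-elim)
open import Function using (flip; _∘_)
open import Level using (0ℓ)
open import Relation.Unary using (Pred; Decidable; _⊆_)
open import Induction.WellFounded using (Acc; acc)
open import Relation.Nullary using (¬_; ¬?; Dec; yes; no; does; _×-dec_)
open import Relation.Nullary.Decidable using (dec-true; dec-false)
open import Relation.Binary.PropositionalEquality
open import Relation.Binary.Construct.Closure.Transitive using (TransClosure; [_]; _∷_; _++_)
open import Relation.Binary.Construct.Closure.ReflexiveTransitive using (Star; ε; _◅_; reverse)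

module _ {A : Set} where

  length≡0⇒[] : ∀ {l : List A} → length l ≡ 0 → l ≡ []
  length≡0⇒[] {[]} _ = refl

  ∈⇒length≢0 : ∀ {y : A} {l} → y ∈ l → ¬ length l ≡ 0
  ∈⇒length≢0 m z = ¬Any[] (subst (_ ∈_) (length≡0⇒[] z) m)

  ≤1-∈⇒singleton : ∀ {l : List A} {p} → length l ≤ 1 → p ∈ l → l ≡ p ∷ []
  ≤1-∈⇒singleton {_ ∷ []} _ (here refl) = refl
  ≤1-∈⇒singleton {_ ∷ _ ∷ _} (s≤s ()) _

  delete : ∀ {x : A} {ys} → x ∈ ys → List A
  delete {ys = _ ∷ ys} (here _) = ys
  delete {ys = y ∷ _} (there p) = y ∷ delete p

  length-delete : ∀ {x : A} {ys} (p : x ∈ ys) → length ys ≡ suc (length (delete p))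
  length-delete (here _) = refl
  length-delete (there p) = cong suc (length-delete p)

  ∈-delete⁺ : ∀ {x z : A} {ys} (p : x ∈ ys) → z ∈ ys → z ≢ x → z ∈ delete p
  ∈-delete⁺ (here refl) (here refl) z≢x = ⊥-elim (z≢x refl)
  ∈-delete⁺ (here _) (there q) _ = q
  ∈-delete⁺ (there p) (here e) _ = here e
  ∈-delete⁺ (there p) (there q) z≢x = there (∈-delete⁺ p q z≢x)

  ∈-delete⁻ : ∀ {x z : A} {ys} (p : x ∈ ys) → z ∈ delete p → z ∈ ys
  ∈-delete⁻ (here _) m = there m
  ∈-delete⁻ (there p) (here e) = here e
  ∈-delete⁻ (there p) (there m) = there (∈-delete⁻ p m)

  unique-⊆⇒length≤ : ∀ {xs ys : List A} → Unique xs → (∀ {z} → z ∈ xs → z ∈ ys) → length xs ≤ length ys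
  unique-⊆⇒length≤ {[]} _ _ = z≤n
  unique-⊆⇒length≤ {x ∷ xs} {ys} (x∉xs ∷ u) ⊆ys = begin
    suc (length xs)             ≤⟨ s≤s (unique-⊆⇒length≤ u (λ m → ∈-delete⁺ x∈ys (⊆ys (there m)) (x≢ m))) ⟩
    suc (length (delete x∈ys))  ≡⟨ length-delete x∈ys ⟨
    length ys                   ∎
    where
    open ≤-Reasoning
    x∈ys = ⊆ys (here refl)
    x≢ : ∀ {z} → z ∈ xs → z ≢ x
    x≢ m refl = All.lookup x∉xs m refl

  filter-filter-⊆ : ∀ {P Q : Pred A 0ℓ} (P? : Decidable P) (Q? : Decidable Q) → P ⊆ Q →
    ∀ xs → filter P? (filter Q? xs) ≡ filter P? xs
  filter-filter-⊆ P? Q? P⊆Q [] = refl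
  filter-filter-⊆ P? Q? P⊆Q (x ∷ xs) with Q? x
  ... | yes _ with P? x
  ...   | yes _ = cong (x ∷_) (filter-filter-⊆ P? Q? P⊆Q xs)
  ...   | no _ = filter-filter-⊆ P? Q? P⊆Q xs
  filter-filter-⊆ P? Q? P⊆Q (x ∷ xs) | no ¬q with P? x
  ...   | yes p = ⊥-elim (¬q (P⊆Q p))
  ...   | no _ = filter-filter-⊆ P? Q? P⊆Q xs

  sum-cong-∈ : ∀ {f g : A → ℕ} l → (∀ {c} → c ∈ l → f c ≡ g c) → sum (map f l) ≡ sum (map g l)
  sum-cong-∈ l f≡g = cong sum (map-cong-local (All.tabulate f≡g))

  sum-zero-∈ : ∀ {f : A → ℕ} l → (∀ {c} → c ∈ l → f c ≡ 0) → sum (map f l) ≡ 0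
  sum-zero-∈ [] _ = refl
  sum-zero-∈ (_ ∷ l) f≡0 = cong₂ _+_ (f≡0 (here refl)) (sum-zero-∈ l (f≡0 ∘ there))

  sum-≥-∈ : ∀ {f : A → ℕ} {c} l → c ∈ l → f c ≤ sum (map f l)
  sum-≥-∈ (_ ∷ l) (here refl) = m≤m+n _ _
  sum-≥-∈ {f} (x ∷ l) (there m) = ≤-trans (sum-≥-∈ l m) (m≤n+m _ (f x))

  sum≢0⇒∃≢0 : ∀ {f : A → ℕ} l → ¬ sum (map f l) ≡ 0 → ∃ λ c → c ∈ l × ¬ f c ≡ 0
  sum≢0⇒∃≢0 [] s≢0 = ⊥-elim (s≢0 refl)
  sum≢0⇒∃≢0 {f} (x ∷ l) s≢0 with f x ≟ 0
  ... | no fx≢0 = x , here refl , fx≢0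
  ... | yes fx≡0 with sum≢0⇒∃≢0 l (λ s≡0 → s≢0 (cong₂ _+_ fx≡0 s≡0))
  ...   | c , m , fc≢0 = c , there m , fc≢0

  sum-map-+ : ∀ (f g : A → ℕ) l → sum (map (λ c → f c + g c) l) ≡ sum (map f l) + sum (map g l)
  sum-map-+ f g [] = refl
  sum-map-+ f g (x ∷ l) rewrite sum-map-+ f g l = interchange (f x) (g x) _ _

  sum-map-* : ∀ (f : A → ℕ) k l → sum (map (λ c → k * f c) l) ≡ k * sum (map f l)
  sum-map-* f k [] = sym (*-zeroʳ k)
  sum-map-* f k (x ∷ l) rewrite sum-map-* f k l = sym (*-distribˡ-+ k (f x) _)

  sum-delete : ∀ (f : A → ℕ) {c} {l : List A} (p : c ∈ l) → sum (map f l) ≡ f c + sum (map f (delete p))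
  sum-delete f (here refl) = refl
  sum-delete f {c} {l = x ∷ _} (there p) rewrite sum-delete f p = x∙yz≈y∙xz (f x) (f c) _

  sum-split-const : ∀ {P : Pred A 0ℓ} (P? : Decidable P) (f : A → ℕ) k → (∀ {x} → P x → f x ≡ k) →
    ∀ l → sum (map f l) ≡ length (filter P? l) * k + sum (map f (filter (¬? ∘ P?) l))
  sum-split-const P? f k f≡k [] = refl
  sum-split-const P? f k f≡k (x ∷ l) with ih ← sum-split-const P? f k f≡k l | P? x
  ... | yes px rewrite f≡k px = trans (cong (k +_) ih) (sym (+-assoc k _ _))
  ... | no _ = trans (cong (f x +_) ih) (x∙yz≈y∙xz (f x) (length (filter P? l) * k) _)

module _ {A B : Set} where

  map-filter-filter-swap : ∀ {P Q : Pred A 0ℓ} {R : Pred B 0ℓ} (f : A → B) (P? : Decidable P) (Q? : Decidable Q)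
    (R? : Decidable R) → (∀ {a} → P a → Q a → R (f a)) → (∀ {a} → P a → R (f a) → Q a) →
    ∀ xs → map f (filter P? (filter Q? xs)) ≡ filter R? (map f (filter P? xs))
  map-filter-filter-swap f P? Q? R? Q⇒R R⇒Q [] = refl
  map-filter-filter-swap f P? Q? R? Q⇒R R⇒Q (x ∷ xs) with Q? x
  ... | yes q with P? x
  ...   | yes p with R? (f x)
  ...     | yes _ = cong (f x ∷_) (map-filter-filter-swap f P? Q? R? Q⇒R R⇒Q xs)
  ...     | no ¬r = ⊥-elim (¬r (Q⇒R p q))
  map-filter-filter-swap f P? Q? R? Q⇒R R⇒Q (x ∷ xs) | yes _ | no _ = map-filter-filter-swap f P? Q? R? Q⇒R R⇒Q xs
  map-filter-filter-swap f P? Q? R? Q⇒R R⇒Q (x ∷ xs) | no ¬q with P? x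
  ...   | yes p with R? (f x)
  ...     | yes r = ⊥-elim (¬q (R⇒Q p r))
  ...     | no _ = map-filter-filter-swap f P? Q? R? Q⇒R R⇒Q xs
  map-filter-filter-swap f P? Q? R? Q⇒R R⇒Q (x ∷ xs) | no _ | no _ = map-filter-filter-swap f P? Q? R? Q⇒R R⇒Q xs

  count-map∘filter : ∀ {P R : Pred A 0ℓ} {Q : Pred B 0ℓ} (f : A → B) (P? : Decidable P) (Q? : Decidable Q)
    (R? : Decidable R) → (∀ {a} → R a → P a × Q (f a)) → (∀ {a} → P a → Q (f a) → R a) →
    ∀ xs → length (filter Q? (map f (filter P? xs))) ≡ length (filter R? xs)
  count-map∘filter f P? Q? R? R⇒PQ PQ⇒R [] = refl
  count-map∘filter f P? Q? R? R⇒PQ PQ⇒R (x ∷ xs) with P? x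
  ... | yes p with Q? (f x)
  ...   | yes q with R? x
  ...     | yes _ = cong suc (count-map∘filter f P? Q? R? R⇒PQ PQ⇒R xs)
  ...     | no ¬r = ⊥-elim (¬r (PQ⇒R p q))
  count-map∘filter f P? Q? R? R⇒PQ PQ⇒R (x ∷ xs) | yes _ | no ¬q with R? x
  ...     | yes r = ⊥-elim (¬q (proj₂ (R⇒PQ r)))
  ...     | no _ = count-map∘filter f P? Q? R? R⇒PQ PQ⇒R xs
  count-map∘filter f P? Q? R? R⇒PQ PQ⇒R (x ∷ xs) | no ¬p with R? x
  ...     | yes r = ⊥-elim (¬p (proj₁ (R⇒PQ r)))
  ...     | no _ = count-map∘filter f P? Q? R? R⇒PQ PQ⇒R xs

≢? : (v x : ℕ) → Dec (x ≢ v)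
≢? v x = ¬? (x ≟ v)

filter-≢-∉ : ∀ {v} {l : List ℕ} → ¬ v ∈ l → filter (≢? v) l ≡ l
filter-≢-∉ v∉l = filter-all (≢? _) (All.tabulate (λ m → λ { refl → v∉l m }))

count : ℕ → List ℕ → ℕ
count v l = length (filter (_≟ v) l)

sum-split-count : ∀ (f : ℕ → ℕ) v l → sum (map f l) ≡ count v l * f v + sum (map f (filter (≢? v) l))
sum-split-count f v = sum-split-const (_≟ v) f (f v) (cong f)

sum-filter-≢ : ∀ (f : ℕ → ℕ) v l → f v ≡ 0 → sum (map f (filter (≢? v) l)) ≡ sum (map f l)
sum-filter-≢ f v l fv≡0 = sym (begin
  sum (map f l)                                  ≡⟨ sum-split-count f v l ⟩
  count v l * f v + sum (map f rest)             ≡⟨ cong (λ n → count v l * n + sum (map f rest)) fv≡0 ⟩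
  count v l * 0 + sum (map f rest)               ≡⟨ cong (_+ sum (map f rest)) (*-zeroʳ (count v l)) ⟩
  sum (map f rest)                               ∎)
  where
  open ≡-Reasoning
  rest = filter (≢? v) l

-- Directed graphs

Reach : Graph → ℕ → ℕ → Set
Reach G = TransClosure (Arc G)

reach-lift : ∀ {G G'} → (∀ {x y} → Arc G' x y → Reach G x y) → ∀ {x y} → Reach G' x y → Reach G x y
reach-lift lift [ a ] = lift a
reach-lift {G} {G'} lift (a ∷ r) = lift a ++ reach-lift {G} {G'} lift r

Comparable : Graph → ℕ → ℕ → Set
Comparable G u w = Reach G u w ⊎ Reach G w u

comparable-lift : ∀ {G G'} → (∀ {x y} → Arc G' x y → Reach G x y) → ∀ {u w} → Comparable G' u w → Comparable G u w
comparable-lift {G} {G'} lift (inj₁ r) = inj₁ (reach-lift {G} {G'} lift r)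
comparable-lift {G} {G'} lift (inj₂ r) = inj₂ (reach-lift {G} {G'} lift r)

child⇒arc : ∀ {G y c} → c ∈ children G y → Arc G y c
child⇒arc {G} {y} m with ∈-map∘filter⁻ proj₂ (λ e → proj₁ e ≟ y) m
... | _ , e∈E , refl , refl = e∈E

arc⇒child : ∀ {G y c} → Arc G y c → c ∈ children G y
arc⇒child {G} {y} {c} a = ∈-map∘filter⁺ proj₂ (λ e → proj₁ e ≟ y) ((y , c) , a , refl , refl)

parent⇒arc : ∀ {G v p} → p ∈ parents G v → Arc G p v
parent⇒arc {G} {v} m with ∈-map∘filter⁻ proj₁ (λ e → proj₂ e ≟ v) m
... | _ , e∈E , refl , refl = e∈E

arc⇒parent : ∀ {G v p} → Arc G p v → p ∈ parents G v
arc⇒parent {G} {v} {p} a = ∈-map∘filter⁺ proj₁ (λ e → proj₂ e ≟ v) ((p , v) , a , refl , refl)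

outdeg≡0⇒children≡[] : ∀ {G y} → outdeg G y ≡ 0 → children G y ≡ []
outdeg≡0⇒children≡[] {G} {y} = length≡0⇒[] {l = children G y}

arc⇒nonLeaf : ∀ {G y c} → Arc G y c → ¬ outdeg G y ≡ 0
arc⇒nonLeaf {G} a = ∈⇒length≢0 (arc⇒child {G} a)

leaf≢nonLeaf : ∀ {G x y} → Leaf G x → ¬ outdeg G y ≡ 0 → y ≢ x
leaf≢nonLeaf (_ , x-leaf) y-nonLeaf refl = y-nonLeaf x-leaf

noArcs⇒outdeg≡0 : ∀ {G u} → E G ≡ [] → outdeg G u ≡ 0
noArcs⇒outdeg≡0 {G} {u} E≡[] = cong (λ es → length (map proj₂ (filter (λ e → proj₁ e ≟ u) es))) E≡[]

sole-parent : ∀ {G x p q} → parents G x ≡ p ∷ [] → Arc G q x → q ≡ p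
sole-parent {G} eq a with subst (_ ∈_) eq (arc⇒parent {G} a)
... | here q≡p = q≡p

reach-via-sole-parent : ∀ {G x p y} → parents G x ≡ p ∷ [] → Reach G y x → y ≡ p ⊎ Reach G y p
reach-via-sole-parent {G} eq [ a ] = inj₁ (sole-parent {G} eq a)
reach-via-sole-parent {G} eq (a ∷ r) with reach-via-sole-parent {G} eq r
... | inj₁ refl = inj₂ [ a ]
... | inj₂ r' = inj₂ (a ∷ r')

count-children≡count-parents : ∀ G q v → count v (children G q) ≡ count q (parents G v)
count-children≡count-parents G q v = trans
  (count-map∘filter proj₂ (λ e → proj₁ e ≟ q) (_≟ v) (λ e → ×-≡-dec _≟_ _≟_ e (q , v))
     (λ { refl → refl , refl }) (λ { refl refl → refl }) (E G))
  (sym (count-map∘filter proj₁ (λ e → proj₂ e ≟ v) (_≟ q) (λ e → ×-≡-dec _≟_ _≟_ e (q , v))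
     (λ { refl → refl , refl }) (λ { refl refl → refl }) (E G)))

sole-parent⇒count≡1 : ∀ G q v → parents G v ≡ q ∷ [] → count v (children G q) ≡ 1
sole-parent⇒count≡1 G q v eq rewrite count-children≡count-parents G q v | eq =
  cong length (filter-accept (_≟ q) {xs = []} refl)

-- The part of the network axioms that survives every cherry reduction.
record Dag (G : Graph) : Set where
  field
    arcEnds        : ∀ {u w} → Arc G u w → u ∈ V G × w ∈ V G
    acyclic        : ∀ {u} → ¬ Reach G u u
    leafParents≤1  : ∀ {x} → x ∈ V G → outdeg G x ≡ 0 → indeg G x ≤ 1
open Dag public

properNetwork⇒dag : ∀ {G} → IsProperNetwork G → Dag G
properNetwork⇒dag P = record
  { arcEnds       = IsProperNetwork.arcsInV P
  ; acyclic       = IsProperNetwork.acyclic P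
  ; leafParents≤1 = λ m z → ≤-reflexive (IsProperNetwork.leafCond P m z) }

target∈V : ∀ {G a b} → Dag G → Reach G a b → b ∈ V G
target∈V D [ x ] = proj₂ (arcEnds D x)
target∈V D (x ∷ r) = target∈V D r

childOf∈V : ∀ {G y c} → Dag G → c ∈ children G y → c ∈ V G
childOf∈V {G} D m = proj₂ (arcEnds D (child⇒arc {G} m))

leaf-parents≡[p] : ∀ {G a p} → Dag G → Leaf G a → Arc G p a → parents G a ≡ p ∷ []
leaf-parents≡[p] {G} D (a∈V , outdeg≡0) a = ≤1-∈⇒singleton (leafParents≤1 D a∈V outdeg≡0) (arc⇒parent {G} a)

-- Well-foundedness of the child relation: a walk of length |V| would repeat a vertex.
data Walk (G : Graph) : ℕ → ℕ → Set where
  stop : ∀ {y} → Walk G 0 y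
  step : ∀ {n y c} → Arc G y c → Walk G n c → Walk G (suc n) y

walkVertices : ∀ {G n y} → Walk G n y → List ℕ
walkVertices {y = y} stop = y ∷ []
walkVertices {y = y} (step _ w) = y ∷ walkVertices w

length-walkVertices : ∀ {G n y} (w : Walk G n y) → length (walkVertices w) ≡ suc n
length-walkVertices stop = refl
length-walkVertices (step _ w) = cong suc (length-walkVertices w)

walkVertex⇒reach : ∀ {G n y z} (w : Walk G n y) → z ∈ walkVertices w → z ≡ y ⊎ Reach G y z
walkVertex⇒reach stop (here e) = inj₁ e
walkVertex⇒reach (step _ _) (here e) = inj₁ e
walkVertex⇒reach (step a w) (there m) with walkVertex⇒reach w m
... | inj₁ refl = inj₂ [ a ]
... | inj₂ r = inj₂ (a ∷ r)

walkVertices-unique : ∀ {G n y} → Dag G → (w : Walk G n y) → Unique (walkVertices w)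
walkVertices-unique D stop = All.[] ∷ AllPairs.[]
walkVertices-unique {G} D (step {y = y} a w) = All.tabulate y≢ ∷ walkVertices-unique D w
  where
  y≢ : ∀ {z} → z ∈ walkVertices w → y ≢ z
  y≢ m refl with walkVertex⇒reach w m
  ... | inj₁ refl = acyclic D [ a ]
  ... | inj₂ r = acyclic D (a ∷ r)

noWalk-|V| : ∀ {G y} → Dag G → y ∈ V G → ¬ Walk G (length (V G)) y
noWalk-|V| {G} D y∈V w = 1+n≰n (subst (_≤ length (V G)) (length-walkVertices w)
  (unique-⊆⇒length≤ (walkVertices-unique D w) ⊆V))
  where
  ⊆V : ∀ {z} → z ∈ walkVertices w → z ∈ V G
  ⊆V m with walkVertex⇒reach w m
  ... | inj₁ refl = y∈V
  ... | inj₂ r = target∈V D r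

Below : Graph → ℕ → ℕ → Set
Below G = flip (Arc G)

noWalk⇒acc : ∀ {G} n y → ¬ Walk G n y → Acc (Below G) y
noWalk⇒acc zero y nw = ⊥-elim (nw stop)
noWalk⇒acc (suc n) y nw = acc (λ a → noWalk⇒acc n _ (λ w → nw (step a w)))

below-acc : ∀ {G y} → Dag G → y ∈ V G → Acc (Below G) y
below-acc {G} D y∈V = noWalk⇒acc (length (V G)) _ (noWalk-|V| D y∈V)

-- Counting paths

δ : ℕ → ℕ → ℕ
δ u x = if does (u ≟ x) then 1 else 0

δ-refl : ∀ y → δ y y ≡ 1
δ-refl y = cong (λ b → if b then 1 else 0) (dec-true (y ≟ y) refl)

δ-≢ : ∀ {y x} → y ≢ x → δ y x ≡ 0
δ-≢ {y} {x} y≢x = cong (λ b → if b then 1 else 0) (dec-false (y ≟ x) y≢x)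

-- Path counts in two graphs are compared by exhibiting solutions of this recursion (solvesPaths-unique).
SolvesPaths : Graph → (ℕ → ℕ) → ℕ → Set
SolvesPaths G π x = ∀ {y} → y ∈ V G → π y ≡ δ y x + sum (map π (children G y))

pathsUpTo-stable : ∀ {G} f y x → ¬ Walk G (suc f) y → pathsUpTo (suc f) G y x ≡ pathsUpTo f G y x
pathsUpTo-stable {G} zero y x nw with children G y in eq
... | [] = +-identityʳ _
... | c ∷ _ = ⊥-elim (nw (step (child⇒arc {G} (subst (c ∈_) (sym eq) (here refl))) stop))
pathsUpTo-stable {G} (suc f) y x nw = cong (δ y x +_) (sum-cong-∈ (children G y)
  (λ m → pathsUpTo-stable f _ x (λ w → nw (step (child⇒arc {G} m) w))))

pathsUpTo-solves : ∀ {G} → Dag G → ∀ f x → (∀ {c} → c ∈ V G → ¬ Walk G f c) →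
                   SolvesPaths G (λ y → pathsUpTo f G y x) x
pathsUpTo-solves D zero x nw y∈V = ⊥-elim (nw y∈V stop)
pathsUpTo-solves {G} D (suc f) x nw {y} _ = cong (δ y x +_) (sum-cong-∈ (children G y)
  (λ m → sym (pathsUpTo-stable f _ x (nw (childOf∈V D m)))))

numPaths-unfold : ∀ {G} → Dag G → ∀ x → SolvesPaths G (λ y → numPaths G y x) x
numPaths-unfold {G} D x = pathsUpTo-solves D (length (V G)) x (noWalk-|V| D)

solvesPaths-unique : ∀ {G π π' x} → Dag G → SolvesPaths G π x → SolvesPaths G π' x →
                     ∀ {y} → y ∈ V G → π y ≡ π' y
solvesPaths-unique {G} {π} {π'} {x} D sol sol' y∈V = go (below-acc D y∈V) y∈V
  where
  go : ∀ {y} → Acc (Below G) y → y ∈ V G → π y ≡ π' y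
  go {y} (acc rs) y∈V = begin
    π y                                ≡⟨ sol y∈V ⟩
    δ y x + sum (map π (children G y))  ≡⟨ cong (δ y x +_) (sum-cong-∈ (children G y)
                                             (λ m → go (rs (child⇒arc {G} m)) (childOf∈V D m))) ⟩
    δ y x + sum (map π' (children G y)) ≡⟨ sol' y∈V ⟨
    π' y                               ∎
    where open ≡-Reasoning

numPaths≢0⇒reach : ∀ {G x y} → Dag G → y ∈ V G → ¬ numPaths G y x ≡ 0 → y ≡ x ⊎ Reach G y x
numPaths≢0⇒reach {G} {x} D y∈V = go (below-acc D y∈V) y∈V
  where
  go : ∀ {y} → Acc (Below G) y → y ∈ V G → ¬ numPaths G y x ≡ 0 → y ≡ x ⊎ Reach G y x
  go {y} (acc rs) y∈V n≢0 with y ≟ x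
  ... | yes y≡x = inj₁ y≡x
  ... | no y≢x with sum≢0⇒∃≢0 (children G y)
                      (λ s≡0 → n≢0 (trans (numPaths-unfold D x y∈V) (cong₂ _+_ (δ-≢ y≢x) s≡0)))
  ...   | c , m , c≢0 with go (rs (child⇒arc {G} m)) (childOf∈V D m) c≢0
  ...     | inj₁ refl = inj₂ [ child⇒arc {G} m ]
  ...     | inj₂ r = inj₂ (child⇒arc {G} m ∷ r)

¬reach⇒numPaths≡0 : ∀ {G x y} → Dag G → y ∈ V G → y ≢ x → ¬ Reach G y x → numPaths G y x ≡ 0
¬reach⇒numPaths≡0 {G} {x} {y} D y∈V y≢x ¬r with numPaths G y x ≟ 0
... | yes n≡0 = n≡0
... | no n≢0 with numPaths≢0⇒reach D y∈V n≢0
...   | inj₁ y≡x = ⊥-elim (y≢x y≡x)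
...   | inj₂ r = ⊥-elim (¬r r)

numPaths-toChild≡0 : ∀ {G y c} → Dag G → Arc G y c → numPaths G c y ≡ 0
numPaths-toChild≡0 D a = ¬reach⇒numPaths≡0 D (proj₂ (arcEnds D a))
  (λ { refl → acyclic D [ a ] }) (λ r → acyclic D (a ∷ r))

numPaths-leaf-self : ∀ {G a} → Dag G → Leaf G a → numPaths G a a ≡ 1
numPaths-leaf-self {G} {a} D (a∈V , outdeg≡0) = begin
  numPaths G a a                                       ≡⟨ numPaths-unfold D a a∈V ⟩
  δ a a + sum (map (λ c → numPaths G c a) (children G a)) ≡⟨ cong₂ (λ d l → d + sum (map (λ c → numPaths G c a) l))
                                                              (δ-refl a) (outdeg≡0⇒children≡[] {G} outdeg≡0) ⟩
  1                                                    ∎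
  where open ≡-Reasoning

numPaths-leaf-other : ∀ {G a x} → Dag G → Leaf G a → x ≢ a → numPaths G a x ≡ 0
numPaths-leaf-other {G} {a} {x} D (a∈V , outdeg≡0) x≢a =
  trans (numPaths-unfold D x a∈V) (cong₂ (λ d l → d + sum (map (λ c → numPaths G c x) l))
    (δ-≢ (x≢a ∘ sym)) (outdeg≡0⇒children≡[] {G} outdeg≡0))

numPaths-arc-≤ : ∀ {G p c} x → Dag G → Arc G p c → numPaths G c x ≤ numPaths G p x
numPaths-arc-≤ {G} {p} x D a = begin
  numPaths G _ x                                         ≤⟨ sum-≥-∈ (children G p) (arc⇒child {G} a) ⟩
  sum (map (λ c → numPaths G c x) (children G p))         ≤⟨ m≤n+m _ (δ p x) ⟩
  δ p x + sum (map (λ c → numPaths G c x) (children G p)) ≡⟨ numPaths-unfold D x (proj₁ (arcEnds D a)) ⟨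
  numPaths G p x                                         ∎
  where open ≤-Reasoning

numPaths-reach-≤ : ∀ {G p c} x → Dag G → Reach G p c → numPaths G c x ≤ numPaths G p x
numPaths-reach-≤ x D [ a ] = numPaths-arc-≤ x D a
numPaths-reach-≤ x D (a ∷ r) = ≤-trans (numPaths-reach-≤ x D r) (numPaths-arc-≤ x D a)

-- w reaches a, and every path to a ends with the arc from its sole parent p.
equalCountToLeaf⇒reachParent : ∀ {G p a w} → Dag G → Arc G p a → Leaf G a → w ∈ V G → ¬ outdeg G w ≡ 0 →
  w ≢ p → numPaths G w a ≡ numPaths G p a → Reach G w p
equalCountToLeaf⇒reachParent {G} {p} {a} {w} D pa la w∈V w-nonLeaf w≢p eq
  with numPaths≢0⇒reach {G} {a} {w} D w∈V w≢0
  where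
  w≢0 : ¬ numPaths G w a ≡ 0
  w≢0 w≡0 = 1+n≰n (begin
    1              ≡⟨ numPaths-leaf-self D la ⟨
    numPaths G a a ≤⟨ numPaths-arc-≤ a D pa ⟩
    numPaths G p a ≡⟨ trans (sym eq) w≡0 ⟩
    0              ∎)
    where open ≤-Reasoning
... | inj₁ refl = ⊥-elim (w-nonLeaf (proj₂ la))
... | inj₂ r with reach-via-sole-parent {G} (leaf-parents≡[p] D la pa) r
...   | inj₁ w≡p = ⊥-elim (w≢p w≡p)
...   | inj₂ r' = r'

numPaths-toLeaf≡toParent : ∀ {G a p} → Dag G → Leaf G a → parents G a ≡ p ∷ [] →
  ∀ {y} → y ∈ V G → y ≢ a → numPaths G y a ≡ numPaths G y p
numPaths-toLeaf≡toParent {G} {a} {p} D la pa≡[p] y∈V = go (below-acc D y∈V) y∈V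
  where
  toA toP : ℕ → ℕ
  toA c = numPaths G c a
  toP c = numPaths G c p

  go : ∀ {y} → Acc (Below G) y → y ∈ V G → y ≢ a → toA y ≡ toP y
  go {y} (acc rs) y∈V y≢a with y ≟ p
  ... | no y≢p = begin
    toA y                                ≡⟨ numPaths-unfold D a y∈V ⟩
    δ y a + sum (map toA (children G y))  ≡⟨ cong₂ _+_ (trans (δ-≢ y≢a) (sym (δ-≢ y≢p)))
                                              (sum-cong-∈ (children G y) child≡) ⟩
    δ y p + sum (map toP (children G y))  ≡⟨ numPaths-unfold D p y∈V ⟨
    toP y                                ∎
    where
    open ≡-Reasoning
    child≡ : ∀ {c} → c ∈ children G y → toA c ≡ toP c
    child≡ m = go (rs (child⇒arc {G} m)) (childOf∈V D m)
      (λ { refl → y≢p (sole-parent {G} pa≡[p] (child⇒arc {G} m)) })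
  ... | yes refl = begin
    toA p                                                    ≡⟨ numPaths-unfold D a y∈V ⟩
    δ p a + sum (map toA (children G p))                      ≡⟨ cong₂ _+_ (δ-≢ y≢a) (sum-split-count toA a (children G p)) ⟩
    count a (children G p) * toA a + sum (map toA others)    ≡⟨ cong₂ (λ m n → m * n + sum (map toA others))
                                                                  (sole-parent⇒count≡1 G p a pa≡[p]) (numPaths-leaf-self D la) ⟩
    1 + sum (map toA others)                                 ≡⟨ cong (1 +_) (sum-cong-∈ others other≡) ⟩
    1 + sum (map toP others)                                 ≡⟨ cong (1 +_) (sum-zero-∈ others (toP≡0 ∘ proj₁ ∘ ∈-filter⁻ (≢? a))) ⟩
    1 + 0                                                    ≡⟨ cong₂ _+_ (δ-refl p) (sum-zero-∈ (children G p) toP≡0) ⟨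
    δ p p + sum (map toP (children G p))                      ≡⟨ numPaths-unfold D p y∈V ⟨
    toP p                                                    ∎
    where
    open ≡-Reasoning
    others = filter (≢? a) (children G p)
    toP≡0 : ∀ {c} → c ∈ children G p → toP c ≡ 0
    toP≡0 m = numPaths-toChild≡0 D (child⇒arc {G} m)
    other≡ : ∀ {c} → c ∈ others → toA c ≡ toP c
    other≡ m with m' , c≢a ← ∈-filter⁻ (≢? a) m = go (rs (child⇒arc {G} m')) (childOf∈V D m') c≢a

SamePathCounts : Graph → ℕ → ℕ → Set
SamePathCounts G u w = ∀ x → Leaf G x → numPaths G u x ≡ numPaths G w x

leaf-below : ∀ {G y} → Dag G → y ∈ V G → ∃ λ x → Leaf G x × 1 ≤ numPaths G y x
leaf-below {G} D y∈V = go (below-acc D y∈V) y∈V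
  where
  go : ∀ {y} → Acc (Below G) y → y ∈ V G → ∃ λ x → Leaf G x × 1 ≤ numPaths G y x
  go {y} (acc rs) y∈V with children G y in eq
  ... | [] = y , ly , ≤-reflexive (sym (numPaths-leaf-self D ly))
    where ly = y∈V , cong length eq
  ... | c ∷ _ = let yc = child⇒arc {G} (subst (c ∈_) (sym eq) (here refl))
                    (x , lx , 1≤c) = go (rs yc) (proj₂ (arcEnds D yc))
                in x , lx , ≤-trans 1≤c (numPaths-arc-≤ x D yc)

-- A second child d of u would give u at least one more path than w to a leaf below d.
samePathCounts⇒sole-child : ∀ {G u c w} → Dag G → Arc G u c → c ≡ w ⊎ Reach G c w →
  SamePathCounts G u w → children G u ≡ c ∷ []
samePathCounts⇒sole-child {G} {u} {c} {w} D uc c⇝w same = sole (arc⇒child {G} uc)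
  where
  second-child⇒⊥ : (c∈ : c ∈ children G u) → ∀ {d} → d ∈ delete c∈ → ⊥
  second-child⇒⊥ c∈ {d} d∈rest = 1+n≰n (≤-trans more (≤-reflexive (same x lx)))
    where
    leaf-d = leaf-below D (childOf∈V D (∈-delete⁻ c∈ d∈rest))
    x = proj₁ leaf-d
    lx = proj₁ (proj₂ leaf-d)
    toX = λ z → numPaths G z x
    w≤c : toX w ≤ toX c
    w≤c = [ (λ { refl → ≤-refl }) , numPaths-reach-≤ x D ]′ c⇝w
    more : suc (toX w) ≤ toX u
    more = begin
      suc (toX w)                                 ≡⟨ +-comm 1 (toX w) ⟩
      toX w + 1                                   ≤⟨ +-mono-≤ w≤c (proj₂ (proj₂ leaf-d)) ⟩
      toX c + toX d                               ≤⟨ +-monoʳ-≤ (toX c) (sum-≥-∈ (delete c∈) d∈rest) ⟩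
      toX c + sum (map toX (delete c∈))           ≡⟨ sum-delete toX c∈ ⟨
      sum (map toX (children G u))                ≤⟨ m≤n+m _ (δ u x) ⟩
      δ u x + sum (map toX (children G u))        ≡⟨ numPaths-unfold D x (proj₁ (arcEnds D uc)) ⟨
      toX u                                       ∎
      where open ≤-Reasoning
  sole : c ∈ children G u → children G u ≡ c ∷ []
  sole c∈ with delete c∈ in eq
  ... | [] = ≤1-∈⇒singleton (≤-reflexive (trans (length-delete c∈) (cong (suc ∘ length) eq))) c∈
  ... | d ∷ _ = ⊥-elim (second-child⇒⊥ c∈ (subst (d ∈_) (sym eq) (here refl)))

samePathCounts-sole-child : ∀ {G u c w} → Dag G → Arc G u c → children G u ≡ c ∷ [] →
  SamePathCounts G u w → SamePathCounts G c w
samePathCounts-sole-child {G} {u} {c} D uc ch≡[c] same x lx = begin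
  numPaths G c x                                              ≡⟨ +-identityʳ _ ⟨
  numPaths G c x + 0                                          ≡⟨ cong₂ (λ d l → d + sum (map (λ z → numPaths G z x) l))
                                                                  (δ-≢ (leaf≢nonLeaf {G} lx (arc⇒nonLeaf {G} uc))) ch≡[c] ⟨
  δ u x + sum (map (λ z → numPaths G z x) (children G u))       ≡⟨ numPaths-unfold D x (proj₁ (arcEnds D uc)) ⟨
  numPaths G u x                                              ≡⟨ same x lx ⟩
  numPaths G _ x                                              ∎
  where open ≡-Reasoning

-- Cherry reductions

∈-removeVertex⁻ : ∀ {G v y} → y ∈ V (removeVertex v G) → y ∈ V G × y ≢ v
∈-removeVertex⁻ {G} {v} = ∈-filter⁻ (≢? v)

∈-removeVertex⁺ : ∀ {G v y} → y ∈ V G → y ≢ v → y ∈ V (removeVertex v G)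
∈-removeVertex⁺ {G} {v} = ∈-filter⁺ (≢? v)

arc-removeVertex⁻ : ∀ {G v x y} → Arc (removeVertex v G) x y → Arc G x y × x ≢ v × y ≢ v
arc-removeVertex⁻ {G} {v} = ∈-filter⁻ (λ e → ¬? (proj₁ e ≟ v) ×-dec ¬? (proj₂ e ≟ v))

children-removeVertex : ∀ G v y → y ≢ v → children (removeVertex v G) y ≡ filter (≢? v) (children G y)
children-removeVertex G v y y≢v = map-filter-filter-swap proj₂ (λ e → proj₁ e ≟ y)
  (λ e → ¬? (proj₁ e ≟ v) ×-dec ¬? (proj₂ e ≟ v)) (≢? v)
  (λ _ → proj₂) (λ { refl c≢v → y≢v , c≢v }) (E G)

parents-removeVertex : ∀ G v y → y ≢ v → parents (removeVertex v G) y ≡ filter (≢? v) (parents G y)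
parents-removeVertex G v y y≢v = map-filter-filter-swap proj₁ (λ e → proj₂ e ≟ y)
  (λ e → ¬? (proj₁ e ≟ v) ×-dec ¬? (proj₂ e ≟ v)) (≢? v)
  (λ _ → proj₁) (λ { refl p≢v → p≢v , y≢v }) (E G)

arc-removeArc⁻ : ∀ {G s t x y} → Arc (removeArc (s , t) G) x y → Arc G x y
arc-removeArc⁻ {G} {s} {t} a = proj₁ (∈-filter⁻ (λ e → ¬? (×-≡-dec _≟_ _≟_ e (s , t))) a)

children-removeArc : ∀ G s t y → y ≢ s → children (removeArc (s , t) G) y ≡ children G y
children-removeArc G s t y y≢s = cong (map proj₂) (filter-filter-⊆ (λ e → proj₁ e ≟ y)
  (λ e → ¬? (×-≡-dec _≟_ _≟_ e (s , t))) (λ { refl refl → y≢s refl }) (E G))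

children-removeArc-source : ∀ G s t → children (removeArc (s , t) G) s ≡ filter (≢? t) (children G s)
children-removeArc-source G s t = map-filter-filter-swap proj₂ (λ e → proj₁ e ≟ s)
  (λ e → ¬? (×-≡-dec _≟_ _≟_ e (s , t))) (≢? t)
  (λ { refl e≢st refl → e≢st refl }) (λ { refl c≢t refl → c≢t refl }) (E G)

parents-removeArc : ∀ G s t y → y ≢ t → parents (removeArc (s , t) G) y ≡ parents G y
parents-removeArc G s t y y≢t = cong (map proj₁) (filter-filter-⊆ (λ e → proj₂ e ≟ y)
  (λ e → ¬? (×-≡-dec _≟_ _≟_ e (s , t))) (λ { refl refl → y≢t refl }) (E G))

parents-removeArc-target : ∀ G s t → parents (removeArc (s , t) G) t ≡ filter (≢? s) (parents G t)
parents-removeArc-target G s t = map-filter-filter-swap proj₁ (λ e → proj₂ e ≟ t)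
  (λ e → ¬? (×-≡-dec _≟_ _≟_ e (s , t))) (≢? s)
  (λ { refl e≢st refl → e≢st refl }) (λ { refl p≢s refl → p≢s refl }) (E G)

-- The graph that suppress v G builds when v has sole parent q and sole child c.
bypass : ℕ → ℕ → ℕ → Graph → Graph
bypass v q c G = graph (V (removeVertex v G)) ((q , c) ∷ E (removeVertex v G))

children-bypass-source : ∀ v q c G → children (bypass v q c G) q ≡ c ∷ children (removeVertex v G) q
children-bypass-source v q c G = cong (map proj₂) (filter-accept (λ e → proj₁ e ≟ q) refl)

children-bypass : ∀ v q c G y → q ≢ y → children (bypass v q c G) y ≡ children (removeVertex v G) y
children-bypass v q c G y q≢y = cong (map proj₂) (filter-reject (λ e → proj₁ e ≟ y) q≢y)

parents-bypass-target : ∀ v q c G → parents (bypass v q c G) c ≡ q ∷ parents (removeVertex v G) c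
parents-bypass-target v q c G = cong (map proj₁) (filter-accept (λ e → proj₂ e ≟ c) refl)

parents-bypass : ∀ v q c G y → c ≢ y → parents (bypass v q c G) y ≡ parents (removeVertex v G) y
parents-bypass v q c G y c≢y = cong (map proj₁) (filter-reject (λ e → proj₂ e ≟ y) c≢y)

arc-bypass⁻ : ∀ {v q c G x y} → Arc (bypass v q c G) x y → (x ≡ q × y ≡ c) ⊎ Arc (removeVertex v G) x y
arc-bypass⁻ (here refl) = inj₁ (refl , refl)
arc-bypass⁻ (there a) = inj₂ a

reduceCherry-root : ∀ G b p → indeg G p ≡ 0 → reduceCherry G b p ≡ removeVertex p (removeVertex b G)
reduceCherry-root G b p indeg≡0 = cong (λ β → if β then removeVertex p (removeVertex b G) else suppress p (removeVertex b G))
  (dec-true (indeg G p ≟ 0) indeg≡0)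

reduceCherry-nonRoot : ∀ G b p → ¬ indeg G p ≡ 0 → reduceCherry G b p ≡ suppress p (removeVertex b G)
reduceCherry-nonRoot G b p indeg≢0 = cong (λ β → if β then removeVertex p (removeVertex b G) else suppress p (removeVertex b G))
  (dec-false (indeg G p ≟ 0) indeg≢0)

record Reduction (G G' : Graph) (v : ℕ) : Set where
  field
    dag            : Dag G'
    survives       : ∀ {y} → y ∈ V G → y ≢ v → y ∈ V G'
    ⊆V             : ∀ {y} → y ∈ V G' → y ∈ V G
    arc⇒reach      : ∀ {x y} → Arc G' x y → Reach G x y
    leaf⁻          : ∀ {y} → y ∈ V G' → outdeg G' y ≡ 0 → outdeg G y ≡ 0
    numPaths-equal : ∀ {y x} → y ∈ V G' → x ∈ V G' → numPaths G' y x ≡ numPaths G y x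

reduction-id : ∀ {G v} → Dag G → Reduction G G v
reduction-id D = record
  { dag = D ; survives = λ m _ → m ; ⊆V = λ m → m ; arc⇒reach = [_]
  ; leaf⁻ = λ _ z → z ; numPaths-equal = λ _ _ → refl }

dag-removeVertex : ∀ {G v} → Dag G → (∀ {y} → y ∈ V G → y ≢ v → outdeg (removeVertex v G) y ≡ 0 → outdeg G y ≡ 0) →
  Dag (removeVertex v G)
dag-removeVertex {G} {v} D leaf⁻ = record
  { arcEnds = λ a → let (a' , x≢v , y≢v) = arc-removeVertex⁻ {G} a in
      ∈-removeVertex⁺ {G} (proj₁ (arcEnds D a')) x≢v , ∈-removeVertex⁺ {G} (proj₂ (arcEnds D a')) y≢v
  ; acyclic = λ r → acyclic D (reach-lift {G} {removeVertex v G} (λ a → [ proj₁ (arc-removeVertex⁻ {G} a) ]) r)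
  ; leafParents≤1 = λ {x} m z → let (x∈V , x≢v) = ∈-removeVertex⁻ {G} m in begin
      indeg (removeVertex v G) x              ≡⟨ cong length (parents-removeVertex G v x x≢v) ⟩
      length (filter (≢? v) (parents G x))    ≤⟨ length-filter (≢? v) (parents G x) ⟩
      indeg G x                               ≤⟨ leafParents≤1 D x∈V (leaf⁻ x∈V x≢v z) ⟩
      1                                       ∎ }
  where open ≤-Reasoning

-- The hypothesis is vacuous when v has no parent, as for the root of a reduced cherry.
reduction-removeVertex : ∀ {G v} → Dag G → (∀ {y} → Arc G y v → outdeg G v ≡ 0 × ∃ λ c → Arc G y c × c ≢ v) →
  Reduction G (removeVertex v G) v
reduction-removeVertex {G} {v} D parent-ok = record
  { dag = D'
  ; survives = ∈-removeVertex⁺ {G}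
  ; ⊆V = proj₁ ∘ ∈-removeVertex⁻ {G}
  ; arc⇒reach = λ a → [ proj₁ (arc-removeVertex⁻ {G} a) ]
  ; leaf⁻ = λ m → leaf⁻ (proj₁ (∈-removeVertex⁻ {G} m)) (proj₂ (∈-removeVertex⁻ {G} m))
  ; numPaths-equal = λ y∈V' x∈V' → sym (solvesPaths-unique D' (solves x∈V') (numPaths-unfold D' _) y∈V') }
  where
  G' = removeVertex v G
  keptChild : ∀ {y c} → y ≢ v → c ∈ children G y → ∃ λ d → d ∈ children G' y
  keptChild {y} {c} y≢v c∈ with c ≟ v
  ... | no c≢v = c , subst (c ∈_) (sym (children-removeVertex G v y y≢v)) (∈-filter⁺ (≢? v) c∈ c≢v)
  ... | yes refl with _ , (d , yd , d≢v) ← parent-ok (child⇒arc {G} c∈) =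
    d , subst (d ∈_) (sym (children-removeVertex G v y y≢v)) (∈-filter⁺ (≢? v) (arc⇒child {G} yd) d≢v)
  leaf⁻ : ∀ {y} → y ∈ V G → y ≢ v → outdeg G' y ≡ 0 → outdeg G y ≡ 0
  leaf⁻ {y} _ y≢v z with children G y in eq
  ... | [] = refl
  ... | c ∷ _ = ⊥-elim (∈⇒length≢0 (proj₂ (keptChild y≢v (subst (c ∈_) (sym eq) (here refl)))) z)
  D' : Dag G'
  D' = dag-removeVertex D leaf⁻
  solves : ∀ {x} → x ∈ V G' → SolvesPaths G' (λ z → numPaths G z x) x
  solves {x} x∈V' {z} z∈V' = trans (numPaths-unfold D x z∈V) (cong (δ z x +_) (begin
    sum (map toX (children G z))                 ≡⟨ drop-v (v ∈? children G z) ⟨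
    sum (map toX (filter (≢? v) (children G z))) ≡⟨ cong (sum ∘ map toX) (children-removeVertex G v z z≢v) ⟨
    sum (map toX (children G' z))                ∎))
    where
    open ≡-Reasoning
    z∈V = proj₁ (∈-removeVertex⁻ {G} z∈V')
    z≢v = proj₂ (∈-removeVertex⁻ {G} z∈V')
    toX = λ c → numPaths G c x
    drop-v : Dec (v ∈ children G z) → sum (map toX (filter (≢? v) (children G z))) ≡ sum (map toX (children G z))
    drop-v (yes v∈) = sum-filter-≢ toX v (children G z)
      (numPaths-leaf-other D (proj₂ (arcEnds D (child⇒arc {G} v∈)) , proj₁ (parent-ok (child⇒arc {G} v∈)))
                           (proj₂ (∈-removeVertex⁻ {G} x∈V')))
    drop-v (no v∉) = cong (sum ∘ map toX) (filter-≢-∉ v∉)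

module _ {G v q c} (D : Dag G) (pv≡[q] : parents G v ≡ q ∷ []) (cv≡[c] : children G v ≡ c ∷ []) where
  private
    G' = bypass v q c G
    qv : Arc G q v
    qv = parent⇒arc {G} (subst (q ∈_) (sym pv≡[q]) (here refl))
    vc : Arc G v c
    vc = child⇒arc {G} (subst (c ∈_) (sym cv≡[c]) (here refl))
    q≢v : q ≢ v
    q≢v refl = acyclic D [ qv ]
    c≢v : c ≢ v
    c≢v refl = acyclic D [ vc ]
    ∈V' : ∀ {y} → y ∈ V G → y ≢ v → y ∈ V G'
    ∈V' = ∈-removeVertex⁺ {G}

    arc⇒reach : ∀ {x y} → Arc G' x y → Reach G x y
    arc⇒reach a with arc-bypass⁻ {v} {q} {c} {G} a
    ... | inj₁ (refl , refl) = qv ∷ [ vc ]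
    ... | inj₂ a' = [ proj₁ (arc-removeVertex⁻ {G} a') ]

    children-other : ∀ {y} → y ≢ v → q ≢ y → children G' y ≡ children G y
    children-other {y} y≢v q≢y = begin
      children G' y                   ≡⟨ children-bypass v q c G y q≢y ⟩
      children (removeVertex v G) y   ≡⟨ children-removeVertex G v y y≢v ⟩
      filter (≢? v) (children G y)     ≡⟨ filter-≢-∉ (λ m → q≢y (sym (sole-parent {G} pv≡[q] (child⇒arc {G} m)))) ⟩
      children G y                    ∎
      where open ≡-Reasoning

    leaf⁻ : ∀ {y} → y ∈ V G' → outdeg G' y ≡ 0 → outdeg G y ≡ 0
    leaf⁻ {y} m z with q ≟ y
    ... | yes refl = ⊥-elim (∈⇒length≢0 (subst (c ∈_) (sym (children-bypass-source v q c G)) (here refl)) z)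
    ... | no q≢y = trans (cong length (sym (children-other (proj₂ (∈-removeVertex⁻ {G} m)) q≢y))) z

    leafParents≤1' : ∀ {x} → x ∈ V G' → outdeg G' x ≡ 0 → indeg G' x ≤ 1
    leafParents≤1' {x} m z with x∈V , x≢v ← ∈-removeVertex⁻ {G} m | c ≟ x
    ... | yes refl = ≤-reflexive (cong length (begin
      parents G' c                               ≡⟨ parents-bypass-target v q c G ⟩
      q ∷ parents (removeVertex v G) c           ≡⟨ cong (q ∷_) (parents-removeVertex G v c c≢v) ⟩
      q ∷ filter (≢? v) (parents G c)            ≡⟨ cong (λ l → q ∷ filter (≢? v) l) pc≡[v] ⟩
      q ∷ filter (≢? v) (v ∷ [])                 ≡⟨ cong (q ∷_) (filter-reject (≢? v) (λ v≢v → v≢v refl)) ⟩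
      q ∷ []                                     ∎))
      where
      open ≡-Reasoning
      pc≡[v] : parents G c ≡ v ∷ []
      pc≡[v] = leaf-parents≡[p] D (x∈V , leaf⁻ m z) vc
    ... | no c≢x = begin
      indeg G' x                             ≡⟨ cong length (parents-bypass v q c G x c≢x) ⟩
      indeg (removeVertex v G) x             ≡⟨ cong length (parents-removeVertex G v x x≢v) ⟩
      length (filter (≢? v) (parents G x))   ≤⟨ length-filter (≢? v) (parents G x) ⟩
      indeg G x                              ≤⟨ leafParents≤1 D x∈V (leaf⁻ m z) ⟩
      1                                      ∎
      where open ≤-Reasoning

    D' : Dag G'
    D' = record
      { arcEnds = ends
      ; acyclic = λ r → acyclic D (reach-lift {G} {G'} arc⇒reach r)
      ; leafParents≤1 = leafParents≤1' }
      where
      ends : ∀ {x y} → Arc G' x y → x ∈ V G' × y ∈ V G'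
      ends a with arc-bypass⁻ {v} {q} {c} {G} a
      ... | inj₁ (refl , refl) = ∈V' (proj₁ (arcEnds D qv)) q≢v , ∈V' (proj₂ (arcEnds D vc)) c≢v
      ... | inj₂ a' = let (a'' , x≢v , y≢v) = arc-removeVertex⁻ {G} a' in
        ∈V' (proj₁ (arcEnds D a'')) x≢v , ∈V' (proj₂ (arcEnds D a'')) y≢v

    solves : ∀ {x} → x ∈ V G' → SolvesPaths G' (λ z → numPaths G z x) x
    solves {x} x∈V' {z} z∈V' with q ≟ z
    ... | no q≢z = trans (numPaths-unfold D x z∈V)
          (cong (λ l → δ z x + sum (map toX l)) (sym (children-other (proj₂ (∈-removeVertex⁻ {G} z∈V')) q≢z)))
      where
      z∈V = proj₁ (∈-removeVertex⁻ {G} z∈V')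
      toX = λ y → numPaths G y x
    ... | yes refl = trans (numPaths-unfold D x (proj₁ (arcEnds D qv))) (cong (δ q x +_) (begin
      sum (map toX (children G q))                                   ≡⟨ sum-split-count toX v (children G q) ⟩
      count v (children G q) * toX v + sum (map toX (filter (≢? v) (children G q)))
          ≡⟨ cong₂ (λ m n → m * n + sum (map toX (filter (≢? v) (children G q))))
                   (sole-parent⇒count≡1 G q v pv≡[q]) toX-v≡toX-c ⟩
      toX c + 0 + sum (map toX (filter (≢? v) (children G q)))       ≡⟨ cong₂ _+_ (+-identityʳ (toX c))
                                                                         (cong (sum ∘ map toX) (sym (children-removeVertex G v q q≢v))) ⟩
      toX c + sum (map toX (children (removeVertex v G) q))          ≡⟨ cong (sum ∘ map toX) (children-bypass-source v q c G) ⟨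
      sum (map toX (children G' q))                                  ∎))
      where
      open ≡-Reasoning
      toX = λ y → numPaths G y x
      toX-v≡toX-c : toX v ≡ toX c
      toX-v≡toX-c = begin
        toX v                                ≡⟨ numPaths-unfold D x (proj₂ (arcEnds D qv)) ⟩
        δ v x + sum (map toX (children G v))  ≡⟨ cong₂ (λ d l → d + sum (map toX l)) (δ-≢ {v} {x} (λ { refl → proj₂ (∈-removeVertex⁻ {G} x∈V') refl })) cv≡[c] ⟩
        toX c + 0                            ≡⟨ +-identityʳ (toX c) ⟩
        toX c                                ∎

  reduction-bypass : Reduction G G' v
  reduction-bypass = record
    { dag = D'
    ; survives = ∈V'
    ; ⊆V = proj₁ ∘ ∈-removeVertex⁻ {G}
    ; arc⇒reach = arc⇒reach
    ; leaf⁻ = leaf⁻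
    ; numPaths-equal = λ y∈V' x∈V' → sym (solvesPaths-unique D' (solves x∈V') (numPaths-unfold D' _) y∈V') }

reduction-suppress : ∀ {G v} → Dag G → Reduction G (suppress v G) v
reduction-suppress {G} {v} D with parents G v in pv | children G v in cv
... | q ∷ [] | c ∷ []      = reduction-bypass D pv cv
... | []                | _ = reduction-id D
... | _ ∷ _ ∷ _         | _ = reduction-id D
... | _ ∷ []            | [] = reduction-id D
... | _ ∷ []            | _ ∷ _ ∷ _ = reduction-id D

reduction-cherryParent : ∀ {G b p} → Dag (removeVertex b G) → p ≢ b →
  Reduction (removeVertex b G) (reduceCherry G b p) p
reduction-cherryParent {G} {b} {p} D₁ p≢b with indeg G p ≟ 0
... | yes indeg≡0 = subst (λ H → Reduction G₁ H p) (sym (reduceCherry-root G b p indeg≡0))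
  (reduction-removeVertex D₁ (λ qp → ⊥-elim (¬Any[] (subst (_ ∈_) no-parents (arc⇒parent {G₁} qp)))))
  where
  G₁ = removeVertex b G
  no-parents : parents G₁ p ≡ []
  no-parents = trans (parents-removeVertex G b p p≢b) (cong (filter (≢? b)) (length≡0⇒[] {l = parents G p} indeg≡0))
... | no indeg≢0 = subst (λ H → Reduction (removeVertex b G) H p) (sym (reduceCherry-nonRoot G b p indeg≢0))
  (reduction-suppress D₁)

comparable-reduce : ∀ {G G' v u w} → Reduction G G' v → Comparable G' u w → Comparable G u w
comparable-reduce {G} {G'} R = comparable-lift {G} {G'} (Reduction.arc⇒reach R)

clones-reduce : ∀ {G G' v u w} → Reduction G G' v → u ≢ v → w ≢ v → Clones G u w → Clones G' u w
clones-reduce {G} {G'} {u = u} {w} R u≢v w≢v (u≢w , (u∈V , u-nonLeaf) , (w∈V , w-nonLeaf) , same) =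
  u≢w , (u∈V' , u-nonLeaf ∘ leaf⁻ u∈V') , (w∈V' , w-nonLeaf ∘ leaf⁻ w∈V') , same'
  where
  open Reduction R
  u∈V' = survives u∈V u≢v
  w∈V' = survives w∈V w≢v
  same' : ∀ x → Leaf G' x → numPaths G' u x ≡ numPaths G' w x
  same' x (x∈V' , x-leaf') = trans (numPaths-equal u∈V' x∈V')
    (trans (same x (⊆V x∈V' , leaf⁻ x∈V' x-leaf')) (sym (numPaths-equal w∈V' x∈V')))

module RemoveArc {G s t a} (D : Dag G) (st : Arc G s t) (sa : Arc G s a) (la : Leaf G a) (a≢t : a ≢ t) where
  G₁ = removeArc (s , t) G
  π₁ = numPaths G₁

  reach₁⇒reach : ∀ {x y} → Reach G₁ x y → Reach G x y
  reach₁⇒reach = reach-lift {G} {G₁} (λ e → [ arc-removeArc⁻ {G} e ])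

  outdeg₁≡0⇔outdeg≡0 : ∀ {y} → (outdeg G y ≡ 0 → outdeg G₁ y ≡ 0) × (outdeg G₁ y ≡ 0 → outdeg G y ≡ 0)
  outdeg₁≡0⇔outdeg≡0 {y} with y ≟ s
  ... | yes refl = (λ z → ⊥-elim (arc⇒nonLeaf {G} sa z)) , (λ z → ⊥-elim (∈⇒length≢0 a∈children₁ z))
    where
    a∈children₁ : a ∈ children G₁ s
    a∈children₁ = subst (a ∈_) (sym (children-removeArc-source G s t)) (∈-filter⁺ (≢? t) (arc⇒child {G} sa) a≢t)
  ... | no y≢s = (λ z → trans (cong length (children-removeArc G s t y y≢s)) z)
               , (λ z → trans (cong length (sym (children-removeArc G s t y y≢s))) z)

  indeg₁≤indeg : ∀ x → indeg G₁ x ≤ indeg G x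
  indeg₁≤indeg x with x ≟ t
  ... | yes refl = ≤-trans (≤-reflexive (cong length (parents-removeArc-target G s t)))
                           (length-filter (≢? s) (parents G t))
  ... | no x≢t = ≤-reflexive (cong length (parents-removeArc G s t x x≢t))

  dag₁ : Dag G₁
  dag₁ = record
    { arcEnds = arcEnds D ∘ arc-removeArc⁻ {G}
    ; acyclic = acyclic D ∘ reach₁⇒reach
    ; leafParents≤1 = λ {x} m z → ≤-trans (indeg₁≤indeg x) (leafParents≤1 D m (proj₂ outdeg₁≡0⇔outdeg≡0 z)) }

  t≢s : t ≢ s
  t≢s refl = acyclic D [ st ]

  π₁[t,s]≡0 : π₁ t s ≡ 0
  π₁[t,s]≡0 = ¬reach⇒numPaths≡0 dag₁ (proj₂ (arcEnds D st)) t≢s (λ r → acyclic D (st ∷ reach₁⇒reach r))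

  k : ℕ
  k = count t (children G s)

  -- A path of G uses the arc (s , t) at most once; if it does, it splits into a G₁-path
  -- to s, one of the k copies of (s , t), and a G₁-path from t.
  module Decomposition (x : ℕ) where
    K : ℕ
    K = k * π₁ t x
    ρ : ℕ → ℕ
    ρ y = π₁ y x + K * π₁ y s

    sum-ρ : ∀ y → sum (map ρ (children G₁ y)) ≡ sum (map (λ c → π₁ c x) (children G₁ y)) + K * sum (map (λ c → π₁ c s) (children G₁ y))
    sum-ρ y = trans (sum-map-+ (λ c → π₁ c x) (λ c → K * π₁ c s) (children G₁ y))
      (cong (sum (map (λ c → π₁ c x) (children G₁ y)) +_) (sum-map-* (λ c → π₁ c s) K (children G₁ y)))

    ρ-unfold-≢s : ∀ {y} → y ∈ V G → y ≢ s → ρ y ≡ δ y x + sum (map ρ (children G y))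
    ρ-unfold-≢s {y} y∈V y≢s = begin
      π₁ y x + K * π₁ y s                     ≡⟨ cong₂ (λ m n → m + K * n) (numPaths-unfold dag₁ x y∈V) (numPaths-unfold dag₁ s y∈V) ⟩
      (δ y x + A) + K * (δ y s + B)            ≡⟨ cong (λ d → (δ y x + A) + K * (d + B)) (δ-≢ y≢s) ⟩
      (δ y x + A) + K * B                     ≡⟨ +-assoc (δ y x) A (K * B) ⟩
      δ y x + (A + K * B)                     ≡⟨ cong (δ y x +_) (sum-ρ y) ⟨
      δ y x + sum (map ρ (children G₁ y))      ≡⟨ cong (λ l → δ y x + sum (map ρ l)) (children-removeArc G s t y y≢s) ⟩
      δ y x + sum (map ρ (children G y))       ∎
      where
      open ≡-Reasoning
      A = sum (map (λ c → π₁ c x) (children G₁ y))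
      B = sum (map (λ c → π₁ c s) (children G₁ y))

    ρ-unfold-s : ρ s ≡ δ s x + sum (map ρ (children G s))
    ρ-unfold-s = begin
      π₁ s x + K * π₁ s s                                      ≡⟨ cong₂ (λ m n → m + K * n) (numPaths-unfold dag₁ x s∈V) (numPaths-unfold dag₁ s s∈V) ⟩
      (δ s x + A) + K * (δ s s + B)                             ≡⟨ cong₂ (λ d b → (δ s x + A) + K * (d + b)) (δ-refl s) B≡0 ⟩
      (δ s x + A) + K * 1                                      ≡⟨ cong ((δ s x + A) +_) (*-identityʳ K) ⟩
      (δ s x + A) + K                                          ≡⟨ +-assoc (δ s x) A K ⟩
      δ s x + (A + K)                                          ≡⟨ cong (δ s x +_) (+-comm A K) ⟩
      δ s x + (k * π₁ t x + A)                                 ≡⟨ cong (λ n → δ s x + (k * n + A)) ρt≡π₁tx ⟨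
      δ s x + (k * ρ t + A)                                    ≡⟨ cong (λ m → δ s x + (k * ρ t + m)) sum-ρ-children₁ ⟨
      δ s x + (k * ρ t + sum (map ρ (children G₁ s)))           ≡⟨ cong (λ l → δ s x + (k * ρ t + sum (map ρ l))) (children-removeArc-source G s t) ⟩
      δ s x + (k * ρ t + sum (map ρ (filter (≢? t) (children G s)))) ≡⟨ cong (δ s x +_) (sum-split-count ρ t (children G s)) ⟨
      δ s x + sum (map ρ (children G s))                        ∎
      where
      open ≡-Reasoning
      s∈V = proj₁ (arcEnds D st)
      A = sum (map (λ c → π₁ c x) (children G₁ s))
      B = sum (map (λ c → π₁ c s) (children G₁ s))
      B≡0 : B ≡ 0
      B≡0 = sum-zero-∈ (children G₁ s) (numPaths-toChild≡0 dag₁ ∘ child⇒arc {G₁})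
      ρt≡π₁tx : ρ t ≡ π₁ t x
      ρt≡π₁tx = trans (cong (λ n → π₁ t x + K * n) π₁[t,s]≡0) (trans (cong (π₁ t x +_) (*-zeroʳ K)) (+-identityʳ _))
      sum-ρ-children₁ : sum (map ρ (children G₁ s)) ≡ A
      sum-ρ-children₁ = trans (sum-ρ s) (trans (cong (λ n → A + K * n) B≡0) (trans (cong (A +_) (*-zeroʳ K)) (+-identityʳ A)))

    ρ-solves : SolvesPaths G ρ x
    ρ-solves {y} y∈V with y ≟ s
    ... | yes refl = ρ-unfold-s
    ... | no y≢s = ρ-unfold-≢s y∈V y≢s

  numPaths-decompose : ∀ x {y} → y ∈ V G → numPaths G y x ≡ π₁ y x + (k * π₁ t x) * π₁ y s
  numPaths-decompose x = solvesPaths-unique D (numPaths-unfold D x) (Decomposition.ρ-solves x)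

  parents₁-a : parents G₁ a ≡ s ∷ []
  parents₁-a = trans (parents-removeArc G s t a a≢t) (leaf-parents≡[p] D la sa)

  π₁[t,a]≡0 : π₁ t a ≡ 0
  π₁[t,a]≡0 = ¬reach⇒numPaths≡0 dag₁ (proj₂ (arcEnds D st)) (a≢t ∘ sym) ¬t⇝a
    where
    ¬t⇝a : ¬ Reach G₁ t a
    ¬t⇝a r with reach-via-sole-parent {G₁} parents₁-a r
    ... | inj₁ t≡s = t≢s t≡s
    ... | inj₂ t⇝s = acyclic D (st ∷ reach₁⇒reach t⇝s)

  comparable₁⇒comparable : ∀ {u w} → Comparable G₁ u w → Comparable G u w
  comparable₁⇒comparable = comparable-lift {G} {G₁} (λ e → [ arc-removeArc⁻ {G} e ])

  -- At the leaf a the correction term vanishes, so clones of G have equally many G₁-paths to s;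
  -- then the correction terms agree at every leaf and cancel.
  clones₁ : ∀ {u w} → Clones G u w → Clones G₁ u w
  clones₁ {u} {w} (u≢w , (u∈V , u-nonLeaf) , (w∈V , w-nonLeaf) , same) =
    u≢w , (u∈V , u-nonLeaf ∘ proj₂ outdeg₁≡0⇔outdeg≡0) , (w∈V , w-nonLeaf ∘ proj₂ outdeg₁≡0⇔outdeg≡0) , same₁
    where
    la₁ : Leaf G₁ a
    la₁ = proj₁ la , proj₁ outdeg₁≡0⇔outdeg≡0 (proj₂ la)
    toA≡π₁s : ∀ {y} → y ∈ V G → ¬ outdeg G y ≡ 0 → numPaths G y a ≡ π₁ y s
    toA≡π₁s {y} y∈V y-nonLeaf = begin
      numPaths G y a                       ≡⟨ numPaths-decompose a y∈V ⟩
      π₁ y a + (k * π₁ t a) * π₁ y s       ≡⟨ cong (λ n → π₁ y a + (k * n) * π₁ y s) π₁[t,a]≡0 ⟩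
      π₁ y a + (k * 0) * π₁ y s            ≡⟨ cong (λ n → π₁ y a + n * π₁ y s) (*-zeroʳ k) ⟩
      π₁ y a + 0                           ≡⟨ +-identityʳ _ ⟩
      π₁ y a                               ≡⟨ numPaths-toLeaf≡toParent dag₁ la₁ parents₁-a y∈V (λ { refl → y-nonLeaf (proj₂ la) }) ⟩
      π₁ y s                               ∎
      where open ≡-Reasoning
    π₁us≡π₁ws : π₁ u s ≡ π₁ w s
    π₁us≡π₁ws = trans (sym (toA≡π₁s u∈V u-nonLeaf)) (trans (same a la) (toA≡π₁s w∈V w-nonLeaf))
    same₁ : ∀ x → Leaf G₁ x → π₁ u x ≡ π₁ w x
    same₁ x (x∈V , x-leaf₁) = +-cancelʳ-≡ _ (π₁ u x) (π₁ w x) (begin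
      π₁ u x + (k * π₁ t x) * π₁ u s ≡⟨ numPaths-decompose x u∈V ⟨
      numPaths G u x                 ≡⟨ same x (x∈V , proj₂ outdeg₁≡0⇔outdeg≡0 x-leaf₁) ⟩
      numPaths G w x                 ≡⟨ numPaths-decompose x w∈V ⟩
      π₁ w x + (k * π₁ t x) * π₁ w s ≡⟨ cong (λ n → π₁ w x + (k * π₁ t x) * n) π₁us≡π₁ws ⟨
      π₁ w x + (k * π₁ t x) * π₁ u s ∎)
      where open ≡-Reasoning

-- Clones in orchard networks are comparable

clone-of-leafParent⇒comparable : ∀ {G p a u w} → Dag G → Arc G p a → Leaf G a → Clones G u w →
  u ≡ p ⊎ w ≡ p → Comparable G u w
clone-of-leafParent⇒comparable D pa la (u≢w , _ , (w∈V , w-nonLeaf) , same) (inj₁ refl) =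
  inj₂ (equalCountToLeaf⇒reachParent D pa la w∈V w-nonLeaf (u≢w ∘ sym) (sym (same _ la)))
clone-of-leafParent⇒comparable D pa la (u≢w , (u∈V , u-nonLeaf) , _ , same) (inj₂ refl) =
  inj₁ (equalCountToLeaf⇒reachParent D pa la u∈V u-nonLeaf u≢w (same _ la))

orchard⇒clones-comparable : ∀ {G} → Orchard G → Dag G → ∀ {u w} → Clones G u w → Comparable G u w
orchard⇒clones-comparable {G} (done (_ , _ , E≡[])) _ (_ , (_ , u-nonLeaf) , _) = ⊥-elim (u-nonLeaf (noArcs⇒outdeg≡0 {G} E≡[]))
orchard⇒clones-comparable {G} (reduce a b p (a≢b , la , lb , pa , pb) O) D {u} {w}
  cl@(_ , (_ , u-nonLeaf) , (_ , w-nonLeaf) , _) with u ≟ p | w ≟ p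
... | yes u≡p | _ = clone-of-leafParent⇒comparable D pa la cl (inj₁ u≡p)
... | no _ | yes w≡p = clone-of-leafParent⇒comparable D pa la cl (inj₂ w≡p)
... | no u≢p | no w≢p =
  comparable-reduce R₁ (comparable-reduce R₂
    (orchard⇒clones-comparable O (Reduction.dag R₂)
      (clones-reduce R₂ u≢p w≢p (clones-reduce R₁ (leaf≢nonLeaf {G} lb u-nonLeaf) (leaf≢nonLeaf {G} lb w-nonLeaf) cl))))
  where
  R₁ : Reduction G (removeVertex b G) b
  R₁ = reduction-removeVertex D (λ yb → proj₂ lb , a ,
    subst (λ y → Arc G y a) (sym (sole-parent {G} (leaf-parents≡[p] D lb pb) yb)) pa , a≢b)
  R₂ = reduction-cherryParent {G} (Reduction.dag R₁) (leaf≢nonLeaf {G} lb (arc⇒nonLeaf {G} pa))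
orchard⇒clones-comparable {G} (cut a b pa pb (a≢b , la , lb , pa-a , pb-b , _ , pa-pb) O) D {u} {w} cl
  with u ≟ pa | w ≟ pa | u ≟ pb | w ≟ pb
... | yes u≡pa | _ | _ | _ = clone-of-leafParent⇒comparable D pa-a la cl (inj₁ u≡pa)
... | no _ | yes w≡pa | _ | _ = clone-of-leafParent⇒comparable D pa-a la cl (inj₂ w≡pa)
... | no _ | no _ | yes u≡pb | _ = clone-of-leafParent⇒comparable D pb-b lb cl (inj₁ u≡pb)
... | no _ | no _ | no _ | yes w≡pb = clone-of-leafParent⇒comparable D pb-b lb cl (inj₂ w≡pb)
... | no u≢pa | no w≢pa | no u≢pb | no w≢pb =
  comparable₁⇒comparable (comparable-reduce R₂ (comparable-reduce R₃
    (orchard⇒clones-comparable O (Reduction.dag R₃)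
      (clones-reduce R₃ u≢pb w≢pb (clones-reduce R₂ u≢pa w≢pa (clones₁ cl))))))
  where
  open RemoveArc D pa-pb pa-a la (leaf≢nonLeaf {G} la (arc⇒nonLeaf {G} pb-b) ∘ sym)
  R₂ = reduction-suppress {v = pa} dag₁
  R₃ = reduction-suppress {v = pb} (Reduction.dag R₂)

-- Reticulation paths and sinks

outdeg≡1⇒reticulation : ∀ {G u} → IsProperNetwork G → u ∈ V G → outdeg G u ≡ 1 → Reticulation G u
outdeg≡1⇒reticulation {G} {u} P u∈V outdeg≡1 with u ≟ IsProperNetwork.root P
... | yes refl = ⊥-elim (1+n≢n (trans (sym (IsProperNetwork.rootOutdeg P)) outdeg≡1))
... | no u≢root with IsProperNetwork.innerCond P u∈V u≢root (λ outdeg≡0 → 0≢1+n (trans (sym outdeg≡0) outdeg≡1))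
...   | inj₁ (_ , outdeg≡2) = ⊥-elim (1+n≢n (trans (sym outdeg≡2) outdeg≡1))
...   | inj₂ (2≤indeg , _) = u∈V , 2≤indeg

RetArc : Graph → ℕ → ℕ → Set
RetArc G u c = Reticulation G u × Arc G u c

RetPath : Graph → ℕ → ℕ → Set
RetPath G = TransClosure (RetArc G)

retArc : ∀ {G u c} → IsProperNetwork G → Arc G u c → children G u ≡ c ∷ [] → RetArc G u c
retArc {G} P uc ch≡[c] = outdeg≡1⇒reticulation P (proj₁ (IsProperNetwork.arcsInV P uc)) (cong length ch≡[c]) , uc

retPath-source : ∀ {G u w} → RetPath G u w → Reticulation G u
retPath-source [ (ru , _) ] = ru
retPath-source ((ru , _) ∷ _) = ru

retPath⇒star : ∀ {G u w} → RetPath G u w → Reticulation G w → Star (RetAdj G) u w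
retPath⇒star [ (ru , uw) ] rw = (ru , rw , inj₁ uw) ◅ ε
retPath⇒star ((ru , uc) ∷ p) rw = (ru , retPath-source p , inj₁ uc) ◅ retPath⇒star p rw

-- Each vertex on the path has outdegree 1 (samePathCounts⇒sole-child), hence is a reticulation.
samePathCounts-descendant⇒retPath : ∀ {G u w} → IsProperNetwork G → Reach G u w → SamePathCounts G u w → RetPath G u w
samePathCounts-descendant⇒retPath {G} P [ uw ] same =
  [ retArc P uw (samePathCounts⇒sole-child (properNetwork⇒dag P) uw (inj₁ refl) same) ]
samePathCounts-descendant⇒retPath {G} P (uc ∷ c⇝w) same =
  retArc P uc ch≡[c] ∷ samePathCounts-descendant⇒retPath P c⇝w (samePathCounts-sole-child D uc ch≡[c] same)
  where
  D = properNetwork⇒dag P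
  ch≡[c] = samePathCounts⇒sole-child D uc (inj₂ c⇝w) same

clones⇒retPath : ∀ {G u w} → IsProperNetwork G → Orchard G → Clones G u w → RetPath G u w ⊎ RetPath G w u
clones⇒retPath P O cl@(_ , _ , _ , same) with orchard⇒clones-comparable O (properNetwork⇒dag P) cl
... | inj₁ u⇝w = inj₁ (samePathCounts-descendant⇒retPath P u⇝w same)
... | inj₂ w⇝u = inj₂ (samePathCounts-descendant⇒retPath P w⇝u (λ x lx → sym (same x lx)))

sameSink-sym : ∀ {G u v} → SameSink G u v → SameSink G v u
sameSink-sym (nu , nv , u~v) = nv , nu , reverse flip-adj u~v
  where
  flip-adj : ∀ {G x y} → RetAdj G x y → RetAdj G y x
  flip-adj (rx , ry , xy) = ry , rx , swap xy

-- The middle vertex of two consecutive reticulation paths is itself a reticulation.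
retPaths⇒sameSink : ∀ {G s m y} → RetPath G s m → RetPath G m y → NonLeaf G s → NonLeaf G m → SameSink G s m
retPaths⇒sameSink s⇝m m⇝y ns nm = ns , nm , retPath⇒star s⇝m (retPath-source m⇝y)

sameSink-among-three : ∀ {G v₁ v₂ v₃} → NonLeaf G v₁ → NonLeaf G v₂ → NonLeaf G v₃ →
  RetPath G v₁ v₂ ⊎ RetPath G v₂ v₁ → RetPath G v₁ v₃ ⊎ RetPath G v₃ v₁ → RetPath G v₂ v₃ ⊎ RetPath G v₃ v₂ →
  SameSink G v₁ v₂ ⊎ SameSink G v₁ v₃ ⊎ SameSink G v₂ v₃
sameSink-among-three n₁ n₂ n₃ (inj₁ r₁₂) _          (inj₁ r₂₃) = inj₁ (retPaths⇒sameSink r₁₂ r₂₃ n₁ n₂)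
sameSink-among-three n₁ n₂ n₃ _          (inj₁ r₁₃) (inj₂ r₃₂) = inj₂ (inj₁ (retPaths⇒sameSink r₁₃ r₃₂ n₁ n₃))
sameSink-among-three n₁ n₂ n₃ (inj₁ r₁₂) (inj₂ r₃₁) _          = inj₂ (inj₁ (sameSink-sym (retPaths⇒sameSink r₃₁ r₁₂ n₃ n₁)))
sameSink-among-three n₁ n₂ n₃ (inj₂ r₂₁) (inj₁ r₁₃) _          = inj₁ (sameSink-sym (retPaths⇒sameSink r₂₁ r₁₃ n₂ n₁))
sameSink-among-three n₁ n₂ n₃ (inj₂ r₂₁) (inj₂ r₃₁) (inj₁ r₂₃) = inj₂ (inj₂ (retPaths⇒sameSink r₂₃ r₃₁ n₂ n₃))
sameSink-among-three n₁ n₂ n₃ (inj₂ r₂₁) (inj₂ r₃₁) (inj₂ r₃₂) = inj₂ (inj₂ (sameSink-sym (retPaths⇒sameSink r₃₂ r₂₁ n₃ n₂)))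

corollary4p5 : (N : Graph) → OrchardNetwork N →
    (v₁ v₂ v₃ : ℕ) → NonLeaf N v₁ → NonLeaf N v₂ → NonLeaf N v₃ →
    v₁ ≢ v₂ → v₁ ≢ v₃ → v₂ ≢ v₃ →
    Clones N v₁ v₂ → Clones N v₁ v₃ → Clones N v₂ v₃ →
    HasSinkOfSize≥2 N × (SameSink N v₁ v₂ ⊎ SameSink N v₁ v₃ ⊎ SameSink N v₂ v₃)
corollary4p5 N (inj₁ (_ , _ , E≡[]) , _) _ _ _ (_ , nonLeaf₁) _ _ _ _ _ _ _ _ =
  ⊥-elim (nonLeaf₁ (noArcs⇒outdeg≡0 {N} E≡[]))
corollary4p5 N (inj₂ P , O) v₁ v₂ v₃ n₁ n₂ n₃ d₁₂ d₁₃ d₂₃ c₁₂ c₁₃ c₂₃ = sinkOfSize≥2 pair , pair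
  where
  pair : SameSink N v₁ v₂ ⊎ SameSink N v₁ v₃ ⊎ SameSink N v₂ v₃
  pair = sameSink-among-three n₁ n₂ n₃ (clones⇒retPath P O c₁₂) (clones⇒retPath P O c₁₃) (clones⇒retPath P O c₂₃)
  sinkOfSize≥2 : SameSink N v₁ v₂ ⊎ SameSink N v₁ v₃ ⊎ SameSink N v₂ v₃ → HasSinkOfSize≥2 N
  sinkOfSize≥2 = [ (λ s → _ , _ , d₁₂ , s) , [ (λ s → _ , _ , d₁₃ , s) , (λ s → _ , _ , d₂₃ , s) ]′ ]′
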